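{- Let $\mathcal{C}$ be a binary projective linear code of effective length $59$ all of whose weights are divisible by $8$, and let $d\in\mathcal{C}$ be a codeword of weight $40$. Let $\mathcal{D}$ be the residual code of $d$ (the restriction of all codewords of $\mathcal{C}$ to the $19$ coordinates where $d$ is zero). Then the weight enumerator of $\mathcal{D}$ is not $1+78x^8+48x^{12}+x^{16}$.
   Context: A binary linear code is projective if its generator matrix has no zero column and no two equal columns. The weight enumerator of a code is $\sum_i A_i x^i$, where $A_i$ is the number of codewords of weight $i$. -}

module Defs where

open import Data.Bool using (Bool; true; false; _xor_)
open import Data.Bool.Properties using () renaming (_≟_ to _≟B_)
open import Data.Nat using (ℕ; zero; suc; _≟_)
open import Data.Fin using (Fin)
open import Data.List using (List; []; _∷_; _++_; map; filter; length; deduplicate)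
open import Data.List.Properties using (≡-dec)
open import Data.Vec using (Vec; []; _∷_; replicate; zipWith; lookup)
open import Relation.Binary.PropositionalEquality using (_≡_)
open import Relation.Nullary using (¬_)
open import Data.Product using (_×_)

-- Words over F₂ are Bool vectors (true = 1); addition is xor.
Word : ℕ → Set
Word n = Vec Bool n

_⊕_ : ∀ {n} → Word n → Word n → Word n
_⊕_ = zipWith _xor_

wt : ∀ {n} → Word n → ℕ
wt [] = 0
wt (true ∷ xs) = suc (wt xs)
wt (false ∷ xs) = wt xs

wtL : List Bool → ℕ
wtL [] = 0
wtL (true ∷ xs) = suc (wtL xs)
wtL (false ∷ xs) = wtL xs

-- All F₂-linear combinations of the given rows (the code generated by the
-- generator matrix whose rows are listed; possibly with repetitions).
span : ∀ {n} → List (Word n) → List (Word n)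
span {n} [] = replicate n false ∷ []
span (r ∷ rs) = span rs ++ map (r ⊕_) (span rs)

column : ∀ {n} → List (Word n) → Fin n → List Bool
column rows j = map (λ r → lookup r j) rows

Projective : ∀ {n} → List (Word n) → Set
Projective {n} rows =
  (∀ (j : Fin n) → ¬ (column rows j ≡ map (λ _ → false) rows)) ×
  (∀ (i j : Fin n) → column rows i ≡ column rows j → i ≡ j)

restrict : ∀ {n} → Word n → Word n → List Bool
restrict [] [] = []
restrict (true ∷ d) (x ∷ xs) = restrict d xs
restrict (false ∷ d) (x ∷ xs) = x ∷ restrict d xs

residual : ∀ {n} → List (Word n) → Word n → List (List Bool)
residual rows d = deduplicate (≡-dec _≟B_) (map (restrict d) (span rows))

coeff : List (List Bool) → ℕ → ℕ
coeff D i = length (filter (λ v → wtL v ≟ i) D)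

target : ℕ → ℕ
target 0 = 1
target 8 = 78
target 12 = 48
target 16 = 1
target _ = 0

module Submission where

-- Let S = span rows be the code, listed with multiplicity, ρ m the weight of the residual word
-- restrict d m, and χsum m = ∑_{j ∈ supp d} (-1)^{m_j} = 40 − 2·|m ∩ supp d|.
--  (1) Restriction to the zeros of d is linear, so every residual word occurs equally often,
--      say c times, in the image of S.  Hence if the residual code had the enumerator
--      1 + 78x⁸ + 48x¹² + x¹⁶, exactly c · A_i words of S would have residual weight i.
--  (2) In a projective code the columns are distinct, so for j ≠ j' the characters
--      m ↦ (-1)^{m_j + m_j'} sum to zero over S; this gives ∑_S (χsum m)² = 40·|S|.
--  (3) The energy (χsum m)² − 64·[8 ∣ ρ m] is non-negative: if 8 ∣ ρ m then, as 8 ∣ wt m,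
--      also 8 ∣ |m ∩ supp d|, so χsum m ∈ {±8, ±24, ±40}.
--  (4) By (1) and (2) the energies sum to c·∑_i A_i (40 − 64·[8 ∣ i]) = c·(80·(−24) + 48·40) = 0,
--      yet the zero word has energy 40² − 64 > 0: a contradiction.

open import Defs
open import Data.Bool using (Bool; true; false; _xor_; if_then_else_)
open import Data.Bool.Properties using (xor-assoc; xor-comm; xor-same) renaming (_≟_ to _≟B_)
open import Data.Nat as ℕ using (ℕ; zero; suc; z≤n; s≤s)
open import Data.Nat.Properties as ℕP using ()
open import Data.Nat.Divisibility using (_∣_; _∣?_; divides; ∣m+n∣m⇒∣n)
open import Data.Integer using (ℤ; +_; -[1+_]; 0ℤ; 1ℤ; -1ℤ; _+_; _*_; _-_; _≤_; _<_; +≤+; +<+)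
open import Data.Integer.Properties as ℤP using ()
open import Data.Integer.Tactic.RingSolver using (solve-∀)
open import Data.List as L using (List; []; _∷_; _++_; map; filter; length)
open import Data.List.Properties using (≡-dec; map-++; map-∘; map-cong; length-map)
open import Data.List.Membership.Propositional using (_∈_; _∉_)
open import Data.List.Membership.Propositional.Properties using (∈-map⁺; ∈-map⁻; ∈-++⁺ˡ; ∈-++⁺ʳ; ∈-++⁻; ∈-deduplicate⁺; ∈-deduplicate⁻)
open import Data.List.Membership.DecPropositional (≡-dec _≟B_) using (_∈?_)
open import Data.List.Relation.Unary.Any using (here; there)
open import Data.List.Relation.Unary.All as All using ([]; _∷_)
import Data.List.Relation.Unary.All.Properties as AllP
open import Data.List.Relation.Unary.Unique.Propositional using (Unique; []; _∷_)
import Data.List.Relation.Unary.Unique.Propositional.Properties as UniqueP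
open import Data.List.Relation.Unary.Unique.DecPropositional.Properties (≡-dec _≟B_) using (deduplicate-!)
open import Data.Vec using ([]; _∷_; replicate; lookup)
open import Data.Vec.Properties using (lookup-zipWith; lookup-replicate; zipWith-assoc; zipWith-comm; zipWith-identityˡ)
open import Data.Fin as F using (Fin; zero; suc)
open import Data.Fin.Properties using (suc-injective)
open import Data.Product using (_×_; _,_; ∃-syntax)
open import Data.Sum using (_⊎_; inj₁; inj₂)
open import Relation.Binary.Definitions using (DecidableEquality)
open import Relation.Binary.PropositionalEquality
open import Relation.Nullary using (¬_; Dec; yes; no; does)
open import Relation.Unary using (Pred; Decidable)
open import Level using (0ℓ)
open import Function using (_∘_; id)
open import Data.Empty using (⊥-elim)

∑ : {A : Set} → (A → ℤ) → List A → ℤ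
∑ f [] = 0ℤ
∑ f (x ∷ xs) = f x + ∑ f xs

module _ {A : Set} where

  ∑-++ : (f : A → ℤ) (xs ys : List A) → ∑ f (xs ++ ys) ≡ ∑ f xs + ∑ f ys
  ∑-++ f [] ys = sym (ℤP.+-identityˡ _)
  ∑-++ f (x ∷ xs) ys = trans (cong (λ s → f x + s) (∑-++ f xs ys)) (sym (ℤP.+-assoc (f x) _ _))

  ∑-map : {B : Set} (f : B → ℤ) (g : A → B) (xs : List A) → ∑ f (map g xs) ≡ ∑ (f ∘ g) xs
  ∑-map f g [] = refl
  ∑-map f g (x ∷ xs) = cong (λ s → f (g x) + s) (∑-map f g xs)

  ∑-cong∈ : {f g : A → ℤ} (xs : List A) → (∀ x → x ∈ xs → f x ≡ g x) → ∑ f xs ≡ ∑ g xs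
  ∑-cong∈ [] e = refl
  ∑-cong∈ (x ∷ xs) e = cong₂ _+_ (e x (here refl)) (∑-cong∈ xs (λ y y∈ → e y (there y∈)))

  ∑-cong : {f g : A → ℤ} → (∀ x → f x ≡ g x) → (xs : List A) → ∑ f xs ≡ ∑ g xs
  ∑-cong e xs = ∑-cong∈ xs (λ x _ → e x)

  ∑-zero : (f : A → ℤ) (xs : List A) → (∀ x → x ∈ xs → f x ≡ 0ℤ) → ∑ f xs ≡ 0ℤ
  ∑-zero f xs e = trans (∑-cong∈ xs e) (zeros xs)
    where zeros : (ys : List A) → ∑ (λ _ → 0ℤ) ys ≡ 0ℤ
          zeros [] = refl
          zeros (y ∷ ys) = trans (ℤP.+-identityˡ _) (zeros ys)

  ∑-+ : (f g : A → ℤ) (xs : List A) → ∑ (λ x → f x + g x) xs ≡ ∑ f xs + ∑ g xs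
  ∑-+ f g [] = refl
  ∑-+ f g (x ∷ xs) rewrite ∑-+ f g xs = interchange (f x) (g x) (∑ f xs) (∑ g xs)
    where interchange : ∀ a b c d → a + b + (c + d) ≡ a + c + (b + d)
          interchange = solve-∀

  ∑-- : (f g : A → ℤ) (xs : List A) → ∑ (λ x → f x - g x) xs ≡ ∑ f xs - ∑ g xs
  ∑-- f g [] = refl
  ∑-- f g (x ∷ xs) rewrite ∑-- f g xs = interchange (f x) (g x) (∑ f xs) (∑ g xs)
    where interchange : ∀ a b c d → a - b + (c - d) ≡ a + c - (b + d)
          interchange = solve-∀

  ∑-*ˡ : (c : ℤ) (f : A → ℤ) (xs : List A) → ∑ (λ x → c * f x) xs ≡ c * ∑ f xs
  ∑-*ˡ c f [] = sym (ℤP.*-zeroʳ c)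
  ∑-*ˡ c f (x ∷ xs) rewrite ∑-*ˡ c f xs = sym (ℤP.*-distribˡ-+ c (f x) _)

  ∑-*ʳ : (c : ℤ) (f : A → ℤ) (xs : List A) → ∑ (λ x → f x * c) xs ≡ ∑ f xs * c
  ∑-*ʳ c f xs = begin
    ∑ (λ x → f x * c) xs  ≡⟨ ∑-cong (λ x → ℤP.*-comm (f x) c) xs ⟩
    ∑ (λ x → c * f x) xs  ≡⟨ ∑-*ˡ c f xs ⟩
    c * ∑ f xs            ≡⟨ ℤP.*-comm c _ ⟩
    ∑ f xs * c            ∎
    where open ≡-Reasoning

  ∑-const : (c : ℤ) (xs : List A) → ∑ (λ _ → c) xs ≡ + length xs * c
  ∑-const c [] = refl
  ∑-const c (x ∷ xs) = begin
    c + ∑ (λ _ → c) xs       ≡⟨ cong (λ s → c + s) (∑-const c xs) ⟩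
    c + + length xs * c      ≡⟨ sym (ℤP.suc-* (+ length xs) c) ⟩
    (1ℤ + + length xs) * c    ∎
    where open ≡-Reasoning

  ∑-nonneg : (f : A → ℤ) (xs : List A) → (∀ x → x ∈ xs → 0ℤ ≤ f x) → 0ℤ ≤ ∑ f xs
  ∑-nonneg f [] h = ℤP.≤-refl
  ∑-nonneg f (x ∷ xs) h = ℤP.+-mono-≤ (h x (here refl)) (∑-nonneg f xs (λ y y∈ → h y (there y∈)))

  ∑-≥-term : (f : A → ℤ) (xs : List A) → (∀ x → x ∈ xs → 0ℤ ≤ f x) → ∀ {y} → y ∈ xs → f y ≤ ∑ f xs
  ∑-≥-term f (x ∷ xs) h (here refl) =
    subst (_≤ f x + ∑ f xs) (ℤP.+-identityʳ (f x))
      (ℤP.+-monoʳ-≤ (f x) (∑-nonneg f xs (λ y y∈ → h y (there y∈))))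
  ∑-≥-term f (x ∷ xs) h {y} (there y∈) =
    subst (_≤ f x + ∑ f xs) (ℤP.+-identityˡ (f y))
      (ℤP.+-mono-≤ (h x (here refl)) (∑-≥-term f xs (λ z z∈ → h z (there z∈)) y∈))

module _ {A B : Set} where

  ∑-swap : (f : A → B → ℤ) (xs : List A) (ys : List B) →
           ∑ (λ x → ∑ (f x) ys) xs ≡ ∑ (λ y → ∑ (λ x → f x y) xs) ys
  ∑-swap f [] ys = sym (∑-zero (λ _ → 0ℤ) ys (λ _ _ → refl))
  ∑-swap f (x ∷ xs) ys rewrite ∑-swap f xs ys = sym (∑-+ (f x) (λ y → ∑ (λ x → f x y) xs) ys)

  ∑-product : (f : A → ℤ) (g : B → ℤ) (xs : List A) (ys : List B) →
              ∑ f xs * ∑ g ys ≡ ∑ (λ x → ∑ (λ y → f x * g y) ys) xs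
  ∑-product f g xs ys = trans (sym (∑-*ʳ (∑ g ys) f xs)) (∑-cong (λ x → sym (∑-*ˡ (f x) g ys)) xs)

𝟙 : ∀ {p} {P : Set p} → Dec P → ℤ
𝟙 P? = if does P? then 1ℤ else 0ℤ

𝟙-nonneg : ∀ {p} {P : Set p} (P? : Dec P) → 0ℤ ≤ 𝟙 P?
𝟙-nonneg P? with does P?
... | true = +≤+ z≤n
... | false = +≤+ z≤n

length-filter : ∀ {A : Set} {p} {P : Pred A p} (P? : Decidable P) (xs : List A) →
                + length (filter P? xs) ≡ ∑ (λ x → 𝟙 (P? x)) xs
length-filter P? [] = refl
length-filter P? (x ∷ xs) with does (P? x)
... | true = trans (ℤP.pos-+ 1 (length (filter P? xs))) (cong (λ s → 1ℤ + s) (length-filter P? xs))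
... | false = trans (length-filter P? xs) (sym (ℤP.+-identityˡ _))

module Delta {A : Set} (_≟_ : DecidableEquality A) where

  δ : A → A → ℤ
  δ x y = 𝟙 (x ≟ y)

  δ-refl : ∀ x → δ x x ≡ 1ℤ
  δ-refl x with x ≟ x
  ... | yes _ = refl
  ... | no x≢x = ⊥-elim (x≢x refl)

  δ-≢ : ∀ {x y} → ¬ x ≡ y → δ x y ≡ 0ℤ
  δ-≢ {x} {y} x≢y with x ≟ y
  ... | yes x≡y = ⊥-elim (x≢y x≡y)
  ... | no _ = refl

  ∑-δ : (g : A → ℤ) {U : List A} → Unique U → ∀ {x} → x ∈ U → ∑ (λ u → δ x u * g u) U ≡ g x
  ∑-δ g {_ ∷ ys} (y∉ys ∷ _) {x} (here refl) = begin
    δ x x * g x + ∑ (λ u → δ x u * g u) ys ≡⟨ cong₂ (λ a b → a * g x + b) (δ-refl x) (∑-zero _ ys absent) ⟩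
    1ℤ * g x + 0ℤ                          ≡⟨ trans (ℤP.+-identityʳ _) (ℤP.*-identityˡ (g x)) ⟩
    g x                                    ∎
    where
      open ≡-Reasoning
      absent : ∀ u → u ∈ ys → δ x u * g u ≡ 0ℤ
      absent u u∈ = cong (_* g u) (δ-≢ (All.lookup y∉ys u∈))
  ∑-δ g {y ∷ ys} (y∉ys ∷ uniq) {x} (there x∈) = begin
    δ x y * g y + ∑ (λ u → δ x u * g u) ys ≡⟨ cong (λ a → a * g y + ∑ (λ u → δ x u * g u) ys) (δ-≢ x≢y) ⟩
    0ℤ * g y + ∑ (λ u → δ x u * g u) ys    ≡⟨ ℤP.+-identityˡ _ ⟩
    ∑ (λ u → δ x u * g u) ys               ≡⟨ ∑-δ g uniq x∈ ⟩
    g x                                    ∎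
    where
      open ≡-Reasoning
      x≢y : ¬ x ≡ y
      x≢y refl = All.lookup y∉ys x∈ refl

  fibre : {B : Set} → (B → A) → List B → A → ℤ
  fibre ρ L u = ∑ (λ x → δ (ρ x) u) L

  ∑-by-fibres : {B : Set} (ρ : B → A) (g : A → ℤ) (L : List B) {U : List A} → Unique U →
                (∀ x → x ∈ L → ρ x ∈ U) → ∑ (g ∘ ρ) L ≡ ∑ (λ u → fibre ρ L u * g u) U
  ∑-by-fibres ρ g L {U} uniq ρ∈U = begin
    ∑ (g ∘ ρ) L                                    ≡⟨ ∑-cong∈ L (λ x x∈ → sym (∑-δ g uniq (ρ∈U x x∈))) ⟩
    ∑ (λ x → ∑ (λ u → δ (ρ x) u * g u) U) L        ≡⟨ ∑-swap (λ x u → δ (ρ x) u * g u) L U ⟩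
    ∑ (λ u → ∑ (λ x → δ (ρ x) u * g u) L) U        ≡⟨ ∑-cong (λ u → ∑-*ʳ (g u) (λ x → δ (ρ x) u) L) U ⟩
    ∑ (λ u → fibre ρ L u * g u) U                  ∎
    where open ≡-Reasoning

  fibre-pos : {B : Set} (ρ : B → A) {L : List B} {x : B} → x ∈ L → 1ℤ ≤ fibre ρ L (ρ x)
  fibre-pos ρ {L} {x} x∈ = subst (_≤ fibre ρ L (ρ x)) (δ-refl (ρ x))
    (∑-≥-term (λ y → δ (ρ y) (ρ x)) L (λ y _ → 𝟙-nonneg (ρ y ≟ ρ x)) x∈)

  mult : List A → A → ℤ
  mult = fibre id

  mult-absent : ∀ {v} L → v ∉ L → mult L v ≡ 0ℤ
  mult-absent {v} L v∉ = ∑-zero _ L (λ x x∈ → δ-≢ (λ { refl → v∉ x∈ }))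

  mult-map-involution : (g : A → A) (L : List A) {v : A} → (∀ x → x ∈ L → g (g x) ≡ x) → g (g v) ≡ v →
                        mult (map g L) v ≡ mult L (g v)
  mult-map-involution g L {v} invL invv = trans (∑-map (λ x → δ x v) g L) (∑-cong∈ L moved)
    where
      moved : ∀ x → x ∈ L → δ (g x) v ≡ δ x (g v)
      moved x x∈ with g x ≟ v | x ≟ g v
      ... | yes _ | yes _ = refl
      ... | no _ | no _ = refl
      ... | yes gx≡v | no x≢gv = ⊥-elim (x≢gv (trans (sym (invL x x∈)) (cong g gx≡v)))
      ... | no gx≢v | yes x≡gv = ⊥-elim (gx≢v (trans (cong g x≡gv) invv))

private variable n : ℕ

⊕-comm : (x y : Word n) → x ⊕ y ≡ y ⊕ x
⊕-comm = zipWith-comm xor-comm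

⊕-assoc : (x y z : Word n) → (x ⊕ y) ⊕ z ≡ x ⊕ (y ⊕ z)
⊕-assoc = zipWith-assoc xor-assoc

⊕-self : (x : Word n) → x ⊕ x ≡ replicate n false
⊕-self [] = refl
⊕-self (b ∷ x) = cong₂ _∷_ (xor-same b) (⊕-self x)

⊕-cancelˡ : (r x : Word n) → r ⊕ (r ⊕ x) ≡ x
⊕-cancelˡ r x = begin
  r ⊕ (r ⊕ x)              ≡⟨ sym (⊕-assoc r r x) ⟩
  (r ⊕ r) ⊕ x              ≡⟨ cong (_⊕ x) (⊕-self r) ⟩
  replicate _ false ⊕ x    ≡⟨ zipWith-identityˡ (λ _ → refl) x ⟩
  x                        ∎
  where open ≡-Reasoning

⊕-cancelʳ : (x r : Word n) → (x ⊕ r) ⊕ r ≡ x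
⊕-cancelʳ x r = trans (⊕-comm (x ⊕ r) r) (trans (cong (r ⊕_) (⊕-comm x r)) (⊕-cancelˡ r x))

⊕-left-comm : (x r y : Word n) → x ⊕ (r ⊕ y) ≡ r ⊕ (x ⊕ y)
⊕-left-comm x r y = trans (sym (⊕-assoc x r y)) (trans (cong (_⊕ y) (⊕-comm x r)) (⊕-assoc r x y))

zero∈span : (rs : List (Word n)) → replicate n false ∈ span rs
zero∈span [] = here refl
zero∈span (r ∷ rs) = ∈-++⁺ˡ (zero∈span rs)

span-cons⁻ : ∀ {r x} (rs : List (Word n)) → x ∈ span (r ∷ rs) →
             ∃[ y ] y ∈ span rs × (x ≡ y ⊎ x ≡ r ⊕ y)
span-cons⁻ {r = r} rs x∈ with ∈-++⁻ (span rs) x∈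
... | inj₁ x∈S = _ , x∈S , inj₁ refl
... | inj₂ x∈rS with ∈-map⁻ (r ⊕_) x∈rS
...   | y , y∈S , x≡r⊕y = y , y∈S , inj₂ x≡r⊕y

span-cons⁺ʳ : ∀ r {y} (rs : List (Word n)) → y ∈ span rs → r ⊕ y ∈ span (r ∷ rs)
span-cons⁺ʳ r rs y∈ = ∈-++⁺ʳ (span rs) (∈-map⁺ (r ⊕_) y∈)

span-closed : (rs : List (Word n)) {x y : Word n} → x ∈ span rs → y ∈ span rs → x ⊕ y ∈ span rs
span-closed [] (here refl) (here refl) = here (⊕-self _)
span-closed (r ∷ rs) x∈ y∈ with span-cons⁻ rs x∈ | span-cons⁻ rs y∈
... | x' , x'∈ , inj₁ refl | y' , y'∈ , inj₁ refl =
  ∈-++⁺ˡ (span-closed rs x'∈ y'∈)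
... | x' , x'∈ , inj₁ refl | y' , y'∈ , inj₂ refl =
  subst (_∈ span (r ∷ rs)) (sym (⊕-left-comm x' r y')) (span-cons⁺ʳ r rs (span-closed rs x'∈ y'∈))
... | x' , x'∈ , inj₂ refl | y' , y'∈ , inj₁ refl =
  subst (_∈ span (r ∷ rs)) (sym (⊕-assoc r x' y')) (span-cons⁺ʳ r rs (span-closed rs x'∈ y'∈))
... | x' , x'∈ , inj₂ refl | y' , y'∈ , inj₂ refl =
  subst (_∈ span (r ∷ rs)) (sym (trans (⊕-assoc r x' (r ⊕ y')) (trans (cong (r ⊕_) (⊕-left-comm x' r y')) (⊕-cancelˡ r (x' ⊕ y')))))
    (∈-++⁺ˡ (span-closed rs x'∈ y'∈))

xorL : List Bool → List Bool → List Bool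
xorL = L.zipWith _xor_

restrict-linear : (d x y : Word n) → restrict d (x ⊕ y) ≡ xorL (restrict d x) (restrict d y)
restrict-linear [] [] [] = refl
restrict-linear (true ∷ d) (a ∷ x) (b ∷ y) = restrict-linear d x y
restrict-linear (false ∷ d) (a ∷ x) (b ∷ y) = cong ((a xor b) ∷_) (restrict-linear d x y)

wtOn : Word n → Word n → ℕ
wtOn [] [] = 0
wtOn (true ∷ d) (true ∷ m) = suc (wtOn d m)
wtOn (true ∷ d) (false ∷ m) = wtOn d m
wtOn (false ∷ d) (_ ∷ m) = wtOn d m

wt-split : (d m : Word n) → wt m ≡ wtOn d m ℕ.+ wtL (restrict d m)
wt-split [] [] = refl
wt-split (true ∷ d) (true ∷ m) = cong suc (wt-split d m)
wt-split (true ∷ d) (false ∷ m) = wt-split d m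
wt-split (false ∷ d) (true ∷ m) = trans (cong suc (wt-split d m)) (sym (ℕP.+-suc (wtOn d m) _))
wt-split (false ∷ d) (false ∷ m) = wt-split d m

wtOn≤wt : (d m : Word n) → wtOn d m ℕ.≤ wt d
wtOn≤wt [] [] = z≤n
wtOn≤wt (true ∷ d) (true ∷ m) = s≤s (wtOn≤wt d m)
wtOn≤wt (true ∷ d) (false ∷ m) = ℕP.m≤n⇒m≤1+n (wtOn≤wt d m)
wtOn≤wt (false ∷ d) (_ ∷ m) = wtOn≤wt d m

-- Multiplicities in the image of a span under an F₂-linear map f are all equal: by induction
-- on the rows, the image M of span rs is extended by its translate f r ⊕ M, which is either M
-- itself (multiplicities double) or disjoint from M (multiplicities are kept).
module LinearImage (f : Word n → List Bool) (f-linear : ∀ x y → f (x ⊕ y) ≡ xorL (f x) (f y)) where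
  open Delta (≡-dec _≟B_)

  image : List (Word n) → List (List Bool)
  image rs = map f (span rs)

  Uniform : List (List Bool) → Set
  Uniform M = ∃[ c ] ∀ v → v ∈ M → mult M v ≡ c

  image-cons : ∀ r rs → image (r ∷ rs) ≡ image rs ++ map (xorL (f r)) (image rs)
  image-cons r rs = begin
    map f (span rs ++ map (r ⊕_) (span rs))          ≡⟨ map-++ f (span rs) _ ⟩
    image rs ++ map f (map (r ⊕_) (span rs))         ≡⟨ cong (image rs ++_) (sym (map-∘ (span rs))) ⟩
    image rs ++ map (f ∘ (r ⊕_)) (span rs)           ≡⟨ cong (image rs ++_) (map-cong (f-linear r) (span rs)) ⟩
    image rs ++ map (xorL (f r) ∘ f) (span rs)       ≡⟨ cong (image rs ++_) (map-∘ (span rs)) ⟩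
    image rs ++ map (xorL (f r)) (image rs)          ∎
    where open ≡-Reasoning

  image-closed : ∀ rs {v w} → v ∈ image rs → w ∈ image rs → xorL v w ∈ image rs
  image-closed rs v∈ w∈ with ∈-map⁻ f v∈ | ∈-map⁻ f w∈
  ... | y , y∈ , refl | z , z∈ , refl = subst (_∈ image rs) (f-linear y z) (∈-map⁺ f (span-closed rs y∈ z∈))

  shift-involutive : ∀ r y → xorL (f r) (xorL (f r) (f y)) ≡ f y
  shift-involutive r y = begin
    xorL (f r) (xorL (f r) (f y))  ≡⟨ cong (xorL (f r)) (sym (f-linear r y)) ⟩
    xorL (f r) (f (r ⊕ y))         ≡⟨ sym (f-linear r (r ⊕ y)) ⟩
    f (r ⊕ (r ⊕ y))                ≡⟨ cong f (⊕-cancelˡ r y) ⟩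
    f y                            ∎
    where open ≡-Reasoning

  shift-back : ∀ r rs {v} → v ∈ image rs → xorL (f r) v ∈ image rs → f r ∈ image rs
  shift-back r rs v∈ rv∈ with ∈-map⁻ f v∈
  ... | y , _ , refl = subst (_∈ image rs) sum≡fr (image-closed rs rv∈ v∈)
    where
      open ≡-Reasoning
      sum≡fr : xorL (xorL (f r) (f y)) (f y) ≡ f r
      sum≡fr = begin
        xorL (xorL (f r) (f y)) (f y)  ≡⟨ cong (λ u → xorL u (f y)) (sym (f-linear r y)) ⟩
        xorL (f (r ⊕ y)) (f y)         ≡⟨ sym (f-linear (r ⊕ y) y) ⟩
        f ((r ⊕ y) ⊕ y)                ≡⟨ cong f (⊕-cancelʳ r y) ⟩
        f r                            ∎

  image-uniform : ∀ rs → Uniform (image rs)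
  image-uniform [] = 1ℤ , λ { v (here refl) → cong (_+ 0ℤ) (δ-refl v) }
  image-uniform (r ∷ rs) with image-uniform rs
  ... | c , uniform = subst Uniform (sym (image-cons r rs)) (extend (f r ∈? M))
    where
      M = image rs
      shift = xorL (f r)

      shift-on-M : ∀ x → x ∈ M → shift (shift x) ≡ x
      shift-on-M x x∈ with ∈-map⁻ f x∈
      ... | y , _ , refl = shift-involutive r y

      shift-on-M′ : ∀ v → v ∈ M ++ map shift M → shift (shift v) ≡ v
      shift-on-M′ v v∈ with ∈-map⁻ f (subst (v ∈_) (sym (image-cons r rs)) v∈)
      ... | y , _ , refl = shift-involutive r y

      mult-split : ∀ v → v ∈ M ++ map shift M → mult (M ++ map shift M) v ≡ mult M v + mult M (shift v)
      mult-split v v∈ = trans (∑-++ _ M (map shift M))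
        (cong (λ s → mult M v + s) (mult-map-involution shift M shift-on-M (shift-on-M′ v v∈)))

      extend : Dec (f r ∈ M) → Uniform (M ++ map shift M)
      extend (yes fr∈M) = c + c , λ v v∈ →
        trans (mult-split v v∈) (cong₂ _+_ (uniform v (in-M v∈)) (uniform _ (image-closed rs fr∈M (in-M v∈))))
        where
          in-M : ∀ {v} → v ∈ M ++ map shift M → v ∈ M
          in-M v∈ with ∈-++⁻ M v∈
          ... | inj₁ v∈M = v∈M
          ... | inj₂ v∈shiftM with ∈-map⁻ shift v∈shiftM
          ...   | x , x∈M , refl = image-closed rs fr∈M x∈M
      extend (no fr∉M) = c , λ v v∈ → trans (mult-split v v∈) (kept v∈)
        where
          kept : ∀ {v} → v ∈ M ++ map shift M → mult M v + mult M (shift v) ≡ c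
          kept {v} v∈ with ∈-++⁻ M v∈
          ... | inj₁ v∈M = trans
                (cong₂ _+_ (uniform v v∈M) (mult-absent M (λ sv∈M → fr∉M (shift-back r rs v∈M sv∈M))))
                (ℤP.+-identityʳ c)
          ... | inj₂ v∈shiftM with ∈-map⁻ shift v∈shiftM
          ...   | x , x∈M , refl = trans
                  (cong₂ _+_ (mult-absent M (λ sx∈M → fr∉M (shift-back r rs x∈M sx∈M)))
                             (trans (cong (mult M) (shift-on-M x x∈M)) (uniform x x∈M)))
                  (ℤP.+-identityˡ c)

residual-count : (rows : List (Word n)) (d : Word n) → ∃[ c ] ∀ {P : Pred (List Bool) 0ℓ} (P? : Decidable P) →
                 ∑ (λ m → 𝟙 (P? (restrict d m))) (span rows) ≡ c * + length (filter P? (residual rows d))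
residual-count rows d with LinearImage.image-uniform (restrict d) (restrict-linear d) rows
... | c , uniform = c , λ P? → begin
  ∑ (λ m → 𝟙 (P? (restrict d m))) (span rows)  ≡⟨ sym (∑-map (𝟙 ∘ P?) (restrict d) (span rows)) ⟩
  ∑ (𝟙 ∘ P?) M                                 ≡⟨ ∑-by-fibres id (𝟙 ∘ P?) M (deduplicate-! M) (λ _ → ∈-deduplicate⁺ (≡-dec _≟B_)) ⟩
  ∑ (λ v → mult M v * 𝟙 (P? v)) D              ≡⟨ ∑-cong∈ D (λ v v∈ → cong (_* 𝟙 (P? v)) (uniform v (∈-deduplicate⁻ (≡-dec _≟B_) M v∈))) ⟩
  ∑ (λ v → c * 𝟙 (P? v)) D                     ≡⟨ ∑-*ˡ c (𝟙 ∘ P?) D ⟩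
  c * ∑ (𝟙 ∘ P?) D                             ≡⟨ cong (c *_) (sym (length-filter P? D)) ⟩
  c * + length (filter P? D)                   ∎
  where
    open ≡-Reasoning
    open Delta (≡-dec _≟B_)
    M = map (restrict d) (span rows)
    D = residual rows d

χ : Bool → ℤ
χ false = 1ℤ
χ true = -1ℤ

χ-xor : ∀ a b → χ (a xor b) ≡ χ a * χ b
χ-xor true true = refl
χ-xor true false = refl
χ-xor false true = refl
χ-xor false false = refl

χ-square : ∀ b → χ b * χ b ≡ 1ℤ
χ-square true = refl
χ-square false = refl

χ-≢ : ∀ {a b} → ¬ a ≡ b → χ a * χ b ≡ -1ℤ
χ-≢ {true} {true} a≢b = ⊥-elim (a≢b refl)
χ-≢ {true} {false} _ = refl
χ-≢ {false} {true} _ = refl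
χ-≢ {false} {false} a≢b = ⊥-elim (a≢b refl)

∑-span-cons : (g : Word n → ℤ) (r : Word n) (rs : List (Word n)) →
              ∑ g (span (r ∷ rs)) ≡ ∑ g (span rs) + ∑ (g ∘ (r ⊕_)) (span rs)
∑-span-cons g r rs = trans (∑-++ g (span rs) _) (cong (λ s → ∑ g (span rs) + s) (∑-map g (r ⊕_) (span rs)))

pairχ : Fin n → Fin n → Word n → ℤ
pairχ j j' m = χ (lookup m j) * χ (lookup m j')

pairχ-⊕ : (j j' : Fin n) (r m : Word n) → pairχ j j' (r ⊕ m) ≡ pairχ j j' r * pairχ j j' m
pairχ-⊕ j j' r m
  rewrite lookup-zipWith _xor_ j r m | lookup-zipWith _xor_ j' r m
        | χ-xor (lookup r j) (lookup m j) | χ-xor (lookup r j') (lookup m j') =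
  interchange (χ (lookup r j)) (χ (lookup m j)) (χ (lookup r j')) (χ (lookup m j'))
  where interchange : ∀ a b c e → (a * b) * (c * e) ≡ (a * c) * (b * e)
        interchange = solve-∀

pairχ-sum : (rows : List (Word n)) (j j' : Fin n) → ¬ column rows j ≡ column rows j' →
            ∑ (pairχ j j') (span rows) ≡ 0ℤ
pairχ-sum [] j j' columns≢ = ⊥-elim (columns≢ refl)
pairχ-sum (r ∷ rs) j j' columns≢ = begin
  ∑ E (span (r ∷ rs))                ≡⟨ ∑-span-cons E r rs ⟩
  ∑ E (span rs) + ∑ (E ∘ (r ⊕_)) (span rs)
      ≡⟨ cong (λ s → ∑ E (span rs) + s) (trans (∑-cong (pairχ-⊕ j j' r) (span rs)) (∑-*ˡ (E r) E (span rs))) ⟩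
  ∑ E (span rs) + E r * ∑ E (span rs)  ≡⟨ cancel (lookup r j ≟B lookup r j') ⟩
  0ℤ                                  ∎
  where
    open ≡-Reasoning
    E = pairχ j j'
    cancel : Dec (lookup r j ≡ lookup r j') → ∑ E (span rs) + E r * ∑ E (span rs) ≡ 0ℤ
    cancel (yes rj≡rj') rewrite pairχ-sum rs j j' (λ cs≡ → columns≢ (cong₂ _∷_ rj≡rj' cs≡)) =
      trans (ℤP.+-identityˡ (E r * 0ℤ)) (ℤP.*-zeroʳ (E r))
    cancel (no rj≢rj') rewrite χ-≢ rj≢rj' = minus-self (∑ E (span rs))
      where minus-self : ∀ s → s + -1ℤ * s ≡ 0ℤ
            minus-self = solve-∀

χsum : List (Fin n) → Word n → ℤ
χsum T m = ∑ (λ j → χ (lookup m j)) T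

second-moment : (rows : List (Word n)) → (∀ i j → column rows i ≡ column rows j → i ≡ j) →
                {T : List (Fin n)} → Unique T →
                ∑ (λ m → χsum T m * χsum T m) (span rows) ≡ + length (span rows) * + length T
second-moment {n = n} rows columns-distinct {T} T-unique = begin
  ∑ (λ m → χsum T m * χsum T m) S                         ≡⟨ ∑-cong (λ m → ∑-product _ _ T T) S ⟩
  ∑ (λ m → ∑ (λ j → ∑ (λ j' → pairχ j j' m) T) T) S       ≡⟨ ∑-swap _ S T ⟩
  ∑ (λ j → ∑ (λ m → ∑ (λ j' → pairχ j j' m) T) S) T       ≡⟨ ∑-cong (λ j → ∑-swap (λ m j' → pairχ j j' m) S T) T ⟩
  ∑ (λ j → ∑ (λ j' → ∑ (pairχ j j') S) T) T               ≡⟨ ∑-cong (λ j → ∑-cong (orthogonality j) T) T ⟩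
  ∑ (λ j → ∑ (λ j' → δ j j' * N) T) T                     ≡⟨ ∑-cong∈ T (λ j j∈ → ∑-δ (λ _ → N) T-unique j∈) ⟩
  ∑ (λ _ → N) T                                           ≡⟨ ∑-const N T ⟩
  + length T * N                                          ≡⟨ ℤP.*-comm (+ length T) N ⟩
  N * + length T                                          ∎
  where
    open ≡-Reasoning
    open Delta (F._≟_ {n})
    S = span rows
    N = + length S
    orthogonality : ∀ j j' → ∑ (pairχ j j') S ≡ δ j j' * N
    orthogonality j j' with j F.≟ j'
    ... | yes refl = begin
      ∑ (pairχ j j) S      ≡⟨ ∑-cong (λ m → χ-square (lookup m j)) S ⟩
      ∑ (λ _ → 1ℤ) S       ≡⟨ ∑-const 1ℤ S ⟩
      N * 1ℤ               ≡⟨ ℤP.*-comm N 1ℤ ⟩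
      1ℤ * N               ∎
    ... | no j≢j' = trans (pairχ-sum rows j j' (λ c≡ → j≢j' (columns-distinct j j' c≡))) (sym (ℤP.*-zeroˡ N))

support : Word n → List (Fin n)
support [] = []
support (true ∷ d) = zero ∷ map suc (support d)
support (false ∷ d) = map suc (support d)

support-unique : (d : Word n) → Unique (support d)
support-unique [] = []
support-unique (true ∷ d) = AllP.map⁺ (All.universal (λ _ ()) (support d)) ∷ UniqueP.map⁺ suc-injective (support-unique d)
support-unique (false ∷ d) = UniqueP.map⁺ suc-injective (support-unique d)

length-support : (d : Word n) → length (support d) ≡ wt d
length-support [] = refl
length-support (true ∷ d) = cong suc (trans (length-map suc (support d)) (length-support d))
length-support (false ∷ d) = trans (length-map suc (support d)) (length-support d)

χsum-suc : (x : Bool) (m : Word n) (T : List (Fin n)) → χsum (map suc T) (x ∷ m) ≡ χsum T m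
χsum-suc x m T = ∑-map (λ j → χ (lookup (x ∷ m) j)) suc T

χsum-support : (d m : Word n) → χsum (support d) m + + 2 * + wtOn d m ≡ + wt d
χsum-support [] [] = refl
χsum-support (true ∷ d) (true ∷ m) = begin
  -1ℤ + χsum (map suc (support d)) (true ∷ m) + + 2 * + suc (wtOn d m)
      ≡⟨ cong₂ (λ s t → -1ℤ + s + + 2 * t) (χsum-suc true m (support d)) (ℤP.pos-+ 1 (wtOn d m)) ⟩
  -1ℤ + χsum (support d) m + + 2 * (1ℤ + + wtOn d m)   ≡⟨ regroup (χsum (support d) m) (+ wtOn d m) ⟩
  1ℤ + (χsum (support d) m + + 2 * + wtOn d m)        ≡⟨ cong (λ s → 1ℤ + s) (χsum-support d m) ⟩
  1ℤ + + wt d                                         ∎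
  where
    open ≡-Reasoning
    regroup : ∀ s a → -1ℤ + s + + 2 * (1ℤ + a) ≡ 1ℤ + (s + + 2 * a)
    regroup = solve-∀
χsum-support (true ∷ d) (false ∷ m) = begin
  1ℤ + χsum (map suc (support d)) (false ∷ m) + + 2 * + wtOn d m
      ≡⟨ cong (λ s → 1ℤ + s + + 2 * + wtOn d m) (χsum-suc false m (support d)) ⟩
  1ℤ + χsum (support d) m + + 2 * + wtOn d m          ≡⟨ ℤP.+-assoc 1ℤ (χsum (support d) m) _ ⟩
  1ℤ + (χsum (support d) m + + 2 * + wtOn d m)        ≡⟨ cong (λ s → 1ℤ + s) (χsum-support d m) ⟩
  1ℤ + + wt d                                         ∎
  where open ≡-Reasoning
χsum-support (false ∷ d) (x ∷ m) =
  trans (cong (λ s → s + + 2 * + wtOn d m) (χsum-suc x m (support d))) (χsum-support d m)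

χsum-zero : (d : Word n) → χsum (support d) (replicate n false) ≡ + wt d
χsum-zero {n} d = begin
  χsum (support d) (replicate n false)   ≡⟨ ∑-cong (λ j → cong χ (lookup-replicate j false)) (support d) ⟩
  ∑ (λ _ → 1ℤ) (support d)               ≡⟨ ∑-const 1ℤ (support d) ⟩
  + length (support d) * 1ℤ              ≡⟨ ℤP.*-identityʳ _ ⟩
  + length (support d)                   ≡⟨ cong +_ (length-support d) ⟩
  + wt d                                 ∎
  where open ≡-Reasoning

support-second-moment : (rows : List (Word n)) → (∀ i j → column rows i ≡ column rows j → i ≡ j) →
                        (d : Word n) → ∑ (λ m → χsum (support d) m * χsum (support d) m - + wt d) (span rows) ≡ 0ℤ
support-second-moment rows columns-distinct d = begin
  ∑ (λ m → χsum T m * χsum T m - + wt d) S               ≡⟨ ∑-- _ _ S ⟩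
  ∑ (λ m → χsum T m * χsum T m) S - ∑ (λ _ → + wt d) S   ≡⟨ cong₂ _-_ (second-moment rows columns-distinct (support-unique d)) (∑-const (+ wt d) S) ⟩
  N * + length T - N * + wt d                            ≡⟨ cong (λ k → N * + k - N * + wt d) (length-support d) ⟩
  N * + wt d - N * + wt d                                ≡⟨ ℤP.+-inverseʳ (N * + wt d) ⟩
  0ℤ                                                     ∎
  where
    open ≡-Reasoning
    S = span rows
    T = support d
    N = + length S

open Delta ℕ._≟_ using (fibre; fibre-pos; ∑-by-fibres)

residual-weight-distribution : (rows : List (Word n)) (d : Word n) (A : ℕ → ℕ) →
  (∀ i → coeff (residual rows d) i ≡ A i) →
  ∃[ c ] ∀ i → fibre (λ m → wtL (restrict d m)) (span rows) i ≡ c * + A i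
residual-weight-distribution rows d A enumerator with residual-count rows d
... | c , count = c , λ i → trans (count (λ v → wtL v ℕ.≟ i)) (cong (λ k → c * + k) (enumerator i))

values-supported : {B : Set} (ρ : B → ℕ) (L : List B) {c : ℤ} {A : ℕ → ℕ} {I : List ℕ} →
                   (∀ i → fibre ρ L i ≡ c * + A i) → (∀ r → A r ≡ 0 ⊎ r ∈ I) → ∀ x → x ∈ L → ρ x ∈ I
values-supported ρ L {c} {A} distribution A-support x x∈ with A-support (ρ x)
... | inj₂ ρx∈I = ρx∈I
... | inj₁ A≡0 with ℤP.≤-trans (fibre-pos ρ x∈) (ℤP.≤-reflexive empty-fibre)
  where
    empty-fibre : fibre ρ L (ρ x) ≡ 0ℤ
    empty-fibre = trans (distribution (ρ x)) (trans (cong (λ k → c * + k) A≡0) (ℤP.*-zeroʳ c))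
... | +≤+ ()

∑-by-distribution : {B : Set} (ρ : B → ℕ) (g : ℕ → ℤ) (L : List B) {c : ℤ} {A : ℕ → ℕ} {I : List ℕ} →
                    Unique I → (∀ x → x ∈ L → ρ x ∈ I) → (∀ i → fibre ρ L i ≡ c * + A i) →
                    ∑ (g ∘ ρ) L ≡ c * ∑ (λ i → + A i * g i) I
∑-by-distribution ρ g L {c} {A} {I} I-unique ρ∈I distribution = begin
  ∑ (g ∘ ρ) L                        ≡⟨ ∑-by-fibres ρ g L I-unique ρ∈I ⟩
  ∑ (λ i → fibre ρ L i * g i) I      ≡⟨ ∑-cong (λ i → trans (cong (_* g i) (distribution i)) (ℤP.*-assoc c (+ A i) (g i))) I ⟩
  ∑ (λ i → c * (+ A i * g i)) I      ≡⟨ ∑-*ˡ c (λ i → + A i * g i) I ⟩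
  c * ∑ (λ i → + A i * g i) I        ∎
  where open ≡-Reasoning

target-weights : List ℕ
target-weights = 0 ∷ 8 ∷ 12 ∷ 16 ∷ []

target-weights-unique : Unique target-weights
target-weights-unique = ((λ ()) ∷ (λ ()) ∷ (λ ()) ∷ []) ∷ ((λ ()) ∷ (λ ()) ∷ []) ∷ ((λ ()) ∷ []) ∷ [] ∷ []

target-support : ∀ r → target r ≡ 0 ⊎ r ∈ target-weights
target-support 0 = inj₂ (here refl)
target-support 1 = inj₁ refl
target-support 2 = inj₁ refl
target-support 3 = inj₁ refl
target-support 4 = inj₁ refl
target-support 5 = inj₁ refl
target-support 6 = inj₁ refl
target-support 7 = inj₁ refl
target-support 8 = inj₂ (there (here refl))
target-support 9 = inj₁ refl
target-support 10 = inj₁ refl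
target-support 11 = inj₁ refl
target-support 12 = inj₂ (there (there (here refl)))
target-support 13 = inj₁ refl
target-support 14 = inj₁ refl
target-support 15 = inj₁ refl
target-support 16 = inj₂ (there (there (there (here refl))))
target-support (suc (suc (suc (suc (suc (suc (suc (suc (suc (suc (suc (suc (suc (suc (suc (suc (suc _))))))))))))))))) = inj₁ refl

test : ℕ → ℤ
test r = + 40 - + 64 * 𝟙 (8 ∣? r)

test-orthogonal : ∑ (λ i → + target i * test i) target-weights ≡ 0ℤ
test-orthogonal = refl

square-nonneg : ∀ b → 0ℤ ≤ b * b
square-nonneg (+ zero) = +≤+ z≤n
square-nonneg (+ suc _) = +≤+ z≤n
square-nonneg -[1+ _ ] = +≤+ z≤n

-- If b = 40 − 2a with a ≤ 40 a multiple of 8, then b ∈ {±8, ±24, ±40}, so b² ≥ 64.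
square-bound : ∀ {a} b → b + + 2 * + a ≡ + 40 → 8 ∣ a → a ℕ.≤ 40 → 0ℤ ≤ b * b - + 64
square-bound {a} b b+2a≡40 (divides q refl) a≤40 =
  subst (λ b → 0ℤ ≤ b * b - + 64) (sym b≡) (multiples q (ℕP.*-cancelʳ-≤ q 5 8 a≤40))
  where
    b≡ : b ≡ + 40 - + 2 * + a
    b≡ = trans (add-sub b (+ 2 * + a)) (cong (_- + 2 * + a) b+2a≡40)
      where add-sub : ∀ x t → x ≡ x + t - t
            add-sub = solve-∀
    multiples : ∀ q → q ℕ.≤ 5 → 0ℤ ≤ (+ 40 - + 2 * + (q ℕ.* 8)) * (+ 40 - + 2 * + (q ℕ.* 8)) - + 64
    multiples 0 _ = +≤+ z≤n
    multiples 1 _ = +≤+ z≤n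
    multiples 2 _ = +≤+ z≤n
    multiples 3 _ = +≤+ z≤n
    multiples 4 _ = +≤+ z≤n
    multiples 5 _ = +≤+ z≤n
    multiples (suc (suc (suc (suc (suc (suc _)))))) (s≤s (s≤s (s≤s (s≤s (s≤s ())))))

energy : Word n → Word n → ℤ
energy d m = χsum (support d) m * χsum (support d) m - + 64 * 𝟙 (8 ∣? wtL (restrict d m))

-- The penalised square b² − 64·[8 ∣ r] is non-negative when b = 40 − 2a with a ≤ 40 and
-- 8 ∣ a + r: if 8 ∣ r then also 8 ∣ a, and square-bound applies.
penalised-square-nonneg : ∀ {a} b r → b + + 2 * + a ≡ + 40 → a ℕ.≤ 40 → 8 ∣ a ℕ.+ r →
                          0ℤ ≤ b * b - + 64 * 𝟙 (8 ∣? r)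
penalised-square-nonneg {a} b r b+2a≡40 a≤40 8∣a+r = by-cases (8 ∣? r)
  where
    by-cases : (8∣r? : Dec (8 ∣ r)) → 0ℤ ≤ b * b - + 64 * 𝟙 8∣r?
    by-cases (yes 8∣r) = square-bound b b+2a≡40 (∣m+n∣m⇒∣n (subst (8 ∣_) (ℕP.+-comm a r) 8∣a+r) 8∣r) a≤40
    by-cases (no _) = subst (0ℤ ≤_) (sym (ℤP.+-identityʳ (b * b))) (square-nonneg b)

penalised-square-40 : ∀ r → 0ℤ < + 40 * + 40 - + 64 * 𝟙 (8 ∣? r)
penalised-square-40 r = by-cases (8 ∣? r)
  where
    by-cases : (8∣r? : Dec (8 ∣ r)) → 0ℤ < + 40 * + 40 - + 64 * 𝟙 8∣r?
    by-cases (yes _) = +<+ (s≤s z≤n)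
    by-cases (no _) = +<+ (s≤s z≤n)

-- For wt d = 40 and 8 ∣ wt m the energy is non-negative, since χsum m = 40 − 2 · wtOn d m
-- and wt m = wtOn d m + (residual weight of m).
energy-nonneg : (d m : Word n) → wt d ≡ 40 → 8 ∣ wt m → 0ℤ ≤ energy d m
energy-nonneg d m wt-d 8∣wt-m =
  penalised-square-nonneg (χsum (support d) m) (wtL (restrict d m))
    (trans (χsum-support d m) (cong +_ wt-d))
    (subst (wtOn d m ℕ.≤_) wt-d (wtOn≤wt d m))
    (subst (8 ∣_) (wt-split d m) 8∣wt-m)

energy-zero : (d : Word n) → wt d ≡ 40 → 0ℤ < energy d (replicate n false)
energy-zero {n} d wt-d =
  subst (λ b → 0ℤ < b * b - + 64 * 𝟙 (8 ∣? wtL (restrict d (replicate n false))))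
    (sym (trans (χsum-zero d) (cong +_ wt-d))) (penalised-square-40 (wtL (restrict d (replicate n false))))

-- If the residual weights are distributed as c · target, the energies sum to zero: the squares
-- contribute |span| · 40 by the second moment, and the rest is c times the orthogonality relation.
energy-sum : (rows : List (Word n)) → (∀ i j → column rows i ≡ column rows j → i ≡ j) →
             (d : Word n) → wt d ≡ 40 → {c : ℤ} →
             (∀ i → fibre (λ m → wtL (restrict d m)) (span rows) i ≡ c * + target i) →
             ∑ (energy d) (span rows) ≡ 0ℤ
energy-sum rows columns-distinct d wt-d {c} distribution = begin
  ∑ (energy d) S                                           ≡⟨ ∑-cong (λ m → split (B m) (𝟙 (8 ∣? ρ m))) S ⟩
  ∑ (λ m → (B m * B m - + 40) + test (ρ m)) S              ≡⟨ ∑-+ _ _ S ⟩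
  ∑ (λ m → B m * B m - + 40) S + ∑ (test ∘ ρ) S            ≡⟨ cong₂ _+_ squares tests ⟩
  0ℤ + c * ∑ (λ i → + target i * test i) target-weights    ≡⟨ cong (λ s → 0ℤ + c * s) test-orthogonal ⟩
  0ℤ + c * 0ℤ                                              ≡⟨ trans (ℤP.+-identityˡ (c * 0ℤ)) (ℤP.*-zeroʳ c) ⟩
  0ℤ                                                       ∎
  where
    open ≡-Reasoning
    S = span rows
    B = χsum (support d)
    ρ = λ m → wtL (restrict d m)
    split : ∀ b e → b * b - + 64 * e ≡ (b * b - + 40) + (+ 40 - + 64 * e)
    split = solve-∀
    squares : ∑ (λ m → B m * B m - + 40) S ≡ 0ℤ
    squares = subst (λ w → ∑ (λ m → B m * B m - + w) S ≡ 0ℤ) wt-d (support-second-moment rows columns-distinct d)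
    tests : ∑ (test ∘ ρ) S ≡ c * ∑ (λ i → + target i * test i) target-weights
    tests = ∑-by-distribution ρ test S {c} {target} target-weights-unique
              (values-supported ρ S {c} {target} distribution target-support) distribution

lemma5 : (rows : List (Word 59)) → Projective rows
    → (∀ c → c ∈ span rows → 8 ∣ wt c)
    → (d : Word 59) → d ∈ span rows → wt d ≡ 40
    → ¬ (∀ (i : ℕ) → coeff (residual rows d) i ≡ target i)
lemma5 rows (_ , columns-distinct) divisible d _ wt-d enumerator
  with residual-weight-distribution rows d target enumerator
... | c , distribution = ℤP.<-irrefl refl (begin-strict
  0ℤ                                  <⟨ energy-zero d wt-d ⟩
  energy d (replicate 59 false)       ≤⟨ ∑-≥-term (energy d) (span rows) energy-nonneg′ (zero∈span rows) ⟩
  ∑ (energy d) (span rows)            ≡⟨ energy-sum rows columns-distinct d wt-d {c} distribution ⟩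
  0ℤ                                  ∎)
  where
    open ℤP.≤-Reasoning
    energy-nonneg′ : ∀ m → m ∈ span rows → 0ℤ ≤ energy d m
    energy-nonneg′ m m∈ = energy-nonneg d m wt-d (divisible m m∈)
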